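{- Let $L\ge2$, $n\ge2$, $1\le g\le L-1$ and $t\ge0$ be integers, and let $m$ be an integer with $gL^t\le m\le L^{n-1}$. Then $\xi_m(K_L^n)\ge\xi_{gL^t}(K_L^n)$.
   Context: $K_L^n$ is the graph on strings $x_n\cdots x_1$ over $\{0,\dots,L-1\}$, adjacent iff they differ in exactly one coordinate. For an integer $0\le m\le L^n$ with base-$L$ expansion $m=\sum_{i=0}^{s}a_iL^{b_i}$ ($a_i\in\{1,\dots,L-1\}$, $b_0>\dots>b_s\ge0$) let $ex_m(K_L^n)=\sum_{i=0}^{s}[(L-1)a_ib_iL^{b_i}+(a_i-1)a_iL^{b_i}]+2\sum_{i=0}^{s-1}\sum_{k=i+1}^{s}a_ia_kL^{b_k}$ ($ex_0=0$), and $\xi_m(K_L^n)=(L-1)nm-ex_m(K_L^n)$. -}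

module Defs where

open import Data.Nat using (ℕ; zero; suc; _+_; _*_; _∸_; _^_; NonZero; _≟_)
open import Data.Nat.DivMod using (_/_; _%_)
open import Data.List using (List; []; _∷_; _++_; [_])
open import Data.Product using (_×_; _,_)
open import Data.Integer as ℤ using (ℤ; +_)
open import Relation.Nullary using (yes; no)

-- Base-L expansion of m: the list of pairs (a_i , b_i) with a_i ∈ {1,…,L-1}
-- the nonzero digits and b_i the positions, ordered with b_0 > b_1 > … > b_s,
-- so that m = Σ a_i L^{b_i}.  'fuel' bounds the recursion; fuel = m suffices
-- when L ≥ 2.  'pos' is the position of the current lowest digit.
digitsAux : (fuel L pos m : ℕ) → .{{NonZero L}} → List (ℕ × ℕ)
digitsAux zero L pos m = []
digitsAux (suc fuel) L pos m with m ≟ 0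
... | yes _ = []
... | no _ with m % L ≟ 0
...   | yes _ = digitsAux fuel L (suc pos) (m / L)
...   | no _  = digitsAux fuel L (suc pos) (m / L) ++ [ (m % L , pos) ]

expansion : (L m : ℕ) → .{{NonZero L}} → List (ℕ × ℕ)
expansion L m = digitsAux m L 0 m

value : (L : ℕ) → List (ℕ × ℕ) → ℕ
value L [] = 0
value L ((a , b) ∷ rest) = a * L ^ b + value L rest

-- ex for an expansion list (a_0,b_0) ∷ … ∷ (a_s,b_s):
--   Σ_i [(L-1) a_i b_i L^{b_i} + (a_i - 1) a_i L^{b_i}]
--   + 2 Σ_{i<k} a_i a_k L^{b_k}
exList : (L : ℕ) → List (ℕ × ℕ) → ℕ
exList L [] = 0
exList L ((a , b) ∷ rest) =
  (L ∸ 1) * a * b * L ^ b + (a ∸ 1) * a * L ^ b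
  + 2 * a * value L rest + exList L rest

-- ex_m(K_L^n)  (independent of n); ex_0 = 0 since the expansion of 0 is empty.
ex : (L m : ℕ) → .{{NonZero L}} → ℕ
ex L m = exList L (expansion L m)

ξ : (L n m : ℕ) → .{{NonZero L}} → ℤ
ξ L n m = + ((L ∸ 1) * n * m) ℤ.- + ex L m

{-# OPTIONS --safe #-}
-- For 1 ≤ a < L and r < Lᵇ the expansion of a·Lᵇ + r is (a, b) followed by that of r, so
-- ex(a·Lᵇ + r) = ex(a·Lᵇ) + 2ar + ex(r), and inductively ex(r) ≤ (L-1)·b·r.  Hence
-- ξ(a·Lᵇ) ≤ ξ(a·Lᵇ + r) whenever b ≤ n - 2: only the leading term of m matters.
-- On the terms g·Lᵗ themselves ξ grows along the lexicographic order of (t, g): raising the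
-- digit g to g + 1 < L adds Lᵗ((L-1)(n-t) - 2g) to ξ, and the carry from (L-1)·Lᵗ to Lᵗ⁺¹
-- adds (L-1)·Lᵗ·(n-t-2), both nonnegative for t ≤ n - 2.  The leading term of any
-- m ≥ g·Lᵗ is lexicographically at least (t, g); the extreme case m = Lⁿ⁻¹ is itself such
-- a term.
module Submission where

open import Defs
open import Data.Nat
  using (ℕ; zero; suc; _+_; _*_; _∸_; _^_; _≤_; _<_; _≟_; z≤n; s≤s; NonZero; ≢-nonZero)
open import Data.Integer as ℤ using (ℤ)
open import Data.Nat.Properties
open import Data.Nat.DivMod using (_/_; _%_; m≡m%n+[m/n]*n; m%n<n; m/n<m)
open import Data.Nat.Tactic.RingSolver using (solve-∀)
import Data.Integer.Properties as ℤₚ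
import Data.Integer.Tactic.RingSolver as ℤ-Solver
open import Data.List using (List; []; _∷_; _++_; [_])
open import Data.List.Relation.Unary.All as All using (All; []; _∷_)
open import Data.List.Relation.Unary.All.Properties using (++⁺)
open import Data.Product using (_×_; _,_; proj₂; ∃-syntax)
open import Data.Sum using (_⊎_; inj₁; inj₂)
open import Data.Unit using (⊤; tt)
open import Data.Empty using (⊥-elim)
open import Function using (_∘_)
open import Relation.Nullary using (yes; no)
open import Relation.Binary.Definitions using (tri<; tri≈; tri>)
open import Relation.Binary.PropositionalEquality hiding ([_])

m*n+o<[1+m]*n : ∀ m {n o} → o < n → m * n + o < suc m * n
m*n+o<[1+m]*n m {n} {o} o<n = begin-strict
  m * n + o  <⟨ +-monoʳ-< (m * n) o<n ⟩
  m * n + n  ≡⟨ +-comm (m * n) n ⟩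
  suc m * n  ∎
  where open ≤-Reasoning

m*o+p≡n*o+q⇒m≡n : ∀ m n {o p q} → p < o → q < o → m * o + p ≡ n * o + q → m ≡ n
m*o+p≡n*o+q⇒m≡n m n p<o q<o eq = ≤-antisym (digit-≤ m n q<o eq) (digit-≤ n m p<o (sym eq))
  where
  digit-≤ : ∀ m n {o p q} → q < o → m * o + p ≡ n * o + q → m ≤ n
  digit-≤ m n {o} {p} {q} q<o eq = ≤-pred (*-cancelʳ-< o m (suc n) (begin-strict
    m * o      ≤⟨ m≤m+n (m * o) p ⟩
    m * o + p  ≡⟨ eq ⟩
    n * o + q  <⟨ m*n+o<[1+m]*n n q<o ⟩
    suc n * o  ∎))
    where open ≤-Reasoning

PositionsBelow : ℕ → List (ℕ × ℕ) → Set
PositionsBelow b = All ((_< b) ∘ proj₂)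

IsExpansion : ℕ → List (ℕ × ℕ) → Set
IsExpansion L [] = ⊤
IsExpansion L ((a , b) ∷ xs) = 1 ≤ a × a < L × PositionsBelow b xs × IsExpansion L xs

value-++ : ∀ L xs ys → value L (xs ++ ys) ≡ value L xs + value L ys
value-++ L [] ys = refl
value-++ L ((a , b) ∷ xs) ys =
  trans (cong (a * L ^ b +_) (value-++ L xs ys)) (sym (+-assoc (a * L ^ b) _ _))

IsExpansion-++-digit : ∀ {L xs d p} → IsExpansion L xs → All ((p <_) ∘ proj₂) xs →
  1 ≤ d → d < L → IsExpansion L (xs ++ [ (d , p) ])
IsExpansion-++-digit {xs = []} _ _ 1≤d d<L = 1≤d , d<L , [] , tt
IsExpansion-++-digit {xs = _ ∷ _} (1≤a , a<L , below , e) (p<b ∷ above) 1≤d d<L =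
  1≤a , a<L , ++⁺ below (p<b ∷ []) , IsExpansion-++-digit e above 1≤d d<L

module _ (L : ℕ) .{{_ : NonZero L}} where

  ^-cancelˡ-< : ∀ {m n} → L ^ m < L ^ n → m < n
  ^-cancelˡ-< lt = ≰⇒> (λ n≤m → <⇒≱ lt (^-monoʳ-≤ L n≤m))

  ^-cancelˡ-≤ : 1 < L → ∀ {m n} → L ^ m ≤ L ^ n → m ≤ n
  ^-cancelˡ-≤ 1<L le = ≮⇒≥ (λ n<m → <⇒≱ (^-monoʳ-< L 1<L n<m) le)

  pow-≤-digit*pow : ∀ {a} b → 1 ≤ a → L ^ b ≤ a * L ^ b
  pow-≤-digit*pow {suc a} b _ = m≤m+n (L ^ b) (a * L ^ b)

  pow-≤-leading-term : ∀ {a} b r → 1 ≤ a → L ^ b ≤ a * L ^ b + r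
  pow-≤-leading-term b r 1≤a = ≤-trans (pow-≤-digit*pow b 1≤a) (m≤m+n _ r)

  leading-term-< : ∀ {a} b {r} → a < L → r < L ^ b → a * L ^ b + r < L ^ suc b
  leading-term-< {a} b a<L r<Lᵇ = <-≤-trans (m*n+o<[1+m]*n a r<Lᵇ) (*-monoˡ-≤ (L ^ b) a<L)

  leading-term-lex : ∀ {g t a b r} → 1 ≤ g → a < L → r < L ^ b → g * L ^ t ≤ a * L ^ b + r →
    t < b ⊎ (t ≡ b × g ≤ a)
  leading-term-lex {g} {t} {a} {b} 1≤g a<L r<Lᵇ le with <-cmp t b
  ... | tri< t<b _ _ = inj₁ t<b
  ... | tri≈ _ refl _ =
    inj₂ (refl , ≤-pred (*-cancelʳ-< (L ^ b) g (suc a) (≤-<-trans le (m*n+o<[1+m]*n a r<Lᵇ))))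
  ... | tri> _ _ b<t = ⊥-elim (<⇒≱ (leading-term-< b a<L r<Lᵇ)
                         (≤-trans (^-monoʳ-≤ L b<t) (≤-trans (pow-≤-digit*pow t 1≤g) le)))

  a*Lᵇ+r≤Lᵇ⇒a≡1∧r≡0 : ∀ {a b r} → 1 ≤ a → a * L ^ b + r ≤ L ^ b → a ≡ 1 × r ≡ 0
  a*Lᵇ+r≤Lᵇ⇒a≡1∧r≡0 {suc a} {b} {r} _ le =
    cong suc (m*n≡0⇒m≡0 a (L ^ b) {{m^n≢0 L b}} (m+n≡0⇒m≡0 _ tail≡0)) , m+n≡0⇒n≡0 _ tail≡0
    where
    open ≤-Reasoning
    tail≡0 : a * L ^ b + r ≡ 0
    tail≡0 = n≤0⇒n≡0 (+-cancelˡ-≤ (L ^ b) _ 0 (begin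
      L ^ b + (a * L ^ b + r)  ≡⟨ sym (+-assoc (L ^ b) _ r) ⟩
      suc a * L ^ b + r        ≤⟨ le ⟩
      L ^ b                    ≡⟨ sym (+-identityʳ (L ^ b)) ⟩
      L ^ b + 0                ∎))

  value-<-pow : ∀ {xs u} → IsExpansion L xs → PositionsBelow u xs → value L xs < L ^ u
  value-<-pow {[]} {u} _ _ = m^n>0 L u
  value-<-pow {(_ , b) ∷ _} (_ , a<L , below , e) (b<u ∷ _) =
    <-≤-trans (leading-term-< b a<L (value-<-pow e below)) (^-monoʳ-≤ L b<u)

  positions-below : ∀ {xs u} → IsExpansion L xs → value L xs < L ^ u → PositionsBelow u xs
  positions-below {[]} _ _ = []
  positions-below {(a , b) ∷ xs} (1≤a , _ , _ , e) lt =
    ^-cancelˡ-< (≤-<-trans (pow-≤-leading-term b (value L xs) 1≤a) lt)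
      ∷ positions-below e (≤-<-trans (m≤n+m (value L xs) (a * L ^ b)) lt)

  value-injective : ∀ {xs ys} → IsExpansion L xs → IsExpansion L ys →
    value L xs ≡ value L ys → xs ≡ ys
  value-injective {[]} {[]} _ _ _ = refl
  value-injective {[]} {(_ , d) ∷ ys} _ (1≤c , _) eq =
    ⊥-elim (<-irrefl eq (<-≤-trans (m^n>0 L d) (pow-≤-leading-term d (value L ys) 1≤c)))
  value-injective {(_ , b) ∷ xs} {[]} (1≤a , _) _ eq =
    ⊥-elim (<-irrefl (sym eq) (<-≤-trans (m^n>0 L b) (pow-≤-leading-term b (value L xs) 1≤a)))
  value-injective {(a , b) ∷ xs} {(c , d) ∷ ys}
    (1≤a , a<L , below₁ , e₁) (1≤c , c<L , below₂ , e₂) eq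
    with ≤-antisym (position-≤ b d xs ys 1≤a c<L below₂ e₂ eq)
                   (position-≤ d b ys xs 1≤c a<L below₁ e₁ (sym eq))
    where
    position-≤ : ∀ {a c} b d xs ys → 1 ≤ a → c < L → PositionsBelow d ys → IsExpansion L ys →
      a * L ^ b + value L xs ≡ c * L ^ d + value L ys → b ≤ d
    position-≤ b d xs ys 1≤a c<L below₂ e₂ eq = ≤-pred (^-cancelˡ-< {b} {suc d}
      (≤-<-trans (pow-≤-leading-term b (value L xs) 1≤a)
        (subst (_< L ^ suc d) (sym eq) (leading-term-< d c<L (value-<-pow e₂ below₂)))))
  ... | refl = cong₂ (λ a zs → (a , b) ∷ zs) a≡c (value-injective e₁ e₂
                 (+-cancelˡ-≡ (a * L ^ b) _ _ (trans eq (cong (λ x → x * L ^ b + value L ys) (sym a≡c)))))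
    where a≡c = m*o+p≡n*o+q⇒m≡n a c (value-<-pow e₁ below₁) (value-<-pow e₂ below₂) eq

  split-last-digit : ∀ m p → m / L * L ^ suc p + m % L * L ^ p ≡ m * L ^ p
  split-last-digit m p = begin
    m / L * (L * L ^ p) + m % L * L ^ p  ≡⟨ cong (_+ m % L * L ^ p) (sym (*-assoc (m / L) L (L ^ p))) ⟩
    m / L * L * L ^ p + m % L * L ^ p    ≡⟨ sym (*-distribʳ-+ (L ^ p) (m / L * L) (m % L)) ⟩
    (m / L * L + m % L) * L ^ p          ≡⟨ cong (_* L ^ p) (+-comm (m / L * L) (m % L)) ⟩
    (m % L + m / L * L) * L ^ p          ≡⟨ cong (_* L ^ p) (sym (m≡m%n+[m/n]*n m L)) ⟩
    m * L ^ p                            ∎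
    where open ≡-Reasoning

  module _ (1<L : 1 < L) where

    digitsAux-correct : ∀ fuel p m → m ≤ fuel →
        IsExpansion L (digitsAux fuel L p m)
      × All ((p ≤_) ∘ proj₂) (digitsAux fuel L p m)
      × value L (digitsAux fuel L p m) ≡ m * L ^ p
    digitsAux-correct zero p .zero z≤n = tt , [] , refl
    digitsAux-correct (suc fuel) p m m≤1+fuel with m ≟ 0
    ... | yes refl = tt , [] , refl
    ... | no m≢0 with m % L ≟ 0 | digitsAux-correct fuel (suc p) (m / L) m/L≤fuel
      where
      m/L≤fuel : m / L ≤ fuel
      m/L≤fuel = ≤-pred (≤-trans (m/n<m m L {{≢-nonZero m≢0}} 1<L) m≤1+fuel)
    ...   | yes m%L≡0 | e , above , eq =
      e , All.map <⇒≤ above , (begin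
        value L (digitsAux fuel L (suc p) (m / L))  ≡⟨ eq ⟩
        m / L * L ^ suc p                           ≡⟨ sym (+-identityʳ _) ⟩
        m / L * L ^ suc p + 0
          ≡⟨ cong (λ r → m / L * L ^ suc p + r * L ^ p) (sym m%L≡0) ⟩
        m / L * L ^ suc p + m % L * L ^ p           ≡⟨ split-last-digit m p ⟩
        m * L ^ p                                   ∎)
      where open ≡-Reasoning
    ...   | no m%L≢0 | e , above , eq =
      IsExpansion-++-digit e above (n≢0⇒n>0 m%L≢0) (m%n<n m L) ,
      ++⁺ (All.map <⇒≤ above) (≤-refl ∷ []) ,
      (begin
        value L (digitsAux fuel L (suc p) (m / L) ++ [ (m % L , p) ])
          ≡⟨ value-++ L (digitsAux fuel L (suc p) (m / L)) _ ⟩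
        value L (digitsAux fuel L (suc p) (m / L)) + (m % L * L ^ p + 0)
          ≡⟨ cong₂ _+_ eq (+-identityʳ _) ⟩
        m / L * L ^ suc p + m % L * L ^ p
          ≡⟨ split-last-digit m p ⟩
        m * L ^ p ∎)
      where open ≡-Reasoning

    expansion-correct : ∀ m → IsExpansion L (expansion L m) × value L (expansion L m) ≡ m
    expansion-correct m =
      let e , _ , eq = digitsAux-correct m 0 m ≤-refl in e , trans eq (*-identityʳ m)

    expansion-leading : ∀ {a b r} → 1 ≤ a → a < L → r < L ^ b →
      expansion L (a * L ^ b + r) ≡ (a , b) ∷ expansion L r
    expansion-leading {a} {b} {r} 1≤a a<L r<Lᵇ
      with expansion-correct (a * L ^ b + r) | expansion-correct r
    ... | e₁ , eq₁ | e₂ , eq₂ =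
      value-injective e₁ (1≤a , a<L , positions-below e₂ (subst (_< L ^ b) (sym eq₂) r<Lᵇ) , e₂)
        (trans eq₁ (cong (a * L ^ b +_) (sym eq₂)))

    leading-digit : ∀ {m} → 0 < m →
      ∃[ a ] ∃[ b ] ∃[ r ] 1 ≤ a × a < L × r < L ^ b × m ≡ a * L ^ b + r
    leading-digit {m} 0<m with expansion L m | expansion-correct m
    ... | [] | _ , refl = ⊥-elim (<-irrefl refl 0<m)
    ... | (a , b) ∷ xs | (1≤a , a<L , below , e) , refl =
      a , b , value L xs , 1≤a , a<L , value-<-pow e below , refl

    leading-term-≤-pow : ∀ {a b r n} → 1 ≤ a → a * L ^ b + r ≤ L ^ n →
      b < n ⊎ (a ≡ 1 × r ≡ 0 × b ≡ n)
    leading-term-≤-pow {a} {b} {r} {n} 1≤a le with m≤n⇒m<n∨m≡n b≤n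
      where b≤n = ^-cancelˡ-≤ 1<L {b} (≤-trans (pow-≤-leading-term b r 1≤a) le)
    ... | inj₁ b<n = inj₁ b<n
    ... | inj₂ refl =
      let a≡1 , r≡0 = a*Lᵇ+r≤Lᵇ⇒a≡1∧r≡0 {a} {b} 1≤a le in inj₂ (a≡1 , r≡0 , refl)

ξ-≤-ξ : ∀ L n v m .{{_ : NonZero L}} →
  (L ∸ 1) * n * v + ex L m ≤ (L ∸ 1) * n * m + ex L v → ξ L n v ℤ.≤ ξ L n m
ξ-≤-ξ L n v m le = subst₂ ℤ._≤_
  (cancelʳ (ℤ.+ ((L ∸ 1) * n * v)) (ℤ.+ ex L v) (ℤ.+ ex L m))
  (cancelˡ (ℤ.+ ((L ∸ 1) * n * m)) (ℤ.+ ex L v) (ℤ.+ ex L m))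
  (ℤₚ.+-monoˡ-≤ (ℤ.- (ℤ.+ ex L v ℤ.+ ℤ.+ ex L m))
    (subst₂ ℤ._≤_ (ℤₚ.pos-+ ((L ∸ 1) * n * v) (ex L m)) (ℤₚ.pos-+ ((L ∸ 1) * n * m) (ex L v))
      (ℤ.+≤+ le)))
  where
  cancelʳ : ∀ x y z → (x ℤ.+ z) ℤ.+ ℤ.- (y ℤ.+ z) ≡ x ℤ.+ ℤ.- y
  cancelʳ = ℤ-Solver.solve-∀
  cancelˡ : ∀ x y z → (x ℤ.+ y) ℤ.+ ℤ.- (y ℤ.+ z) ≡ x ℤ.+ ℤ.- z
  cancelˡ = ℤ-Solver.solve-∀

exList-cons-≤ : ∀ {a c X V} b → 1 ≤ a → a ≤ c → V < X →
  c * a * b * X + (a ∸ 1) * a * X + 2 * a * V + c * b * V ≤ c * suc b * (a * X + V)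
exList-cons-≤ {suc a} {c} {X} {V} b _ a≤c V<X with m≤n⇒∃[o]m+o≡n a≤c | m≤n⇒∃[o]m+o≡n V<X
... | e , refl | x , refl = ≤″⇒≤ record
  { quotient = suc a * suc e * suc x + suc a * e * V + e * V ; equality = identity a e x V b }
  where
  identity : ∀ a e x V b →
      (suc a + e) * suc a * b * suc (V + x) + a * suc a * suc (V + x) + 2 * suc a * V
        + (suc a + e) * b * V + (suc a * suc e * suc x + suc a * e * V + e * V)
    ≡ (suc a + e) * suc b * (suc a * suc (V + x) + V)
  identity = solve-∀

-- The hypothesis of ξ-≤-ξ between a·Lᵗ and (a+1)·Lᵗ, and between (L-1)·Lᵗ and Lᵗ⁺¹ (c = L - 1),
-- with ex of these numbers written out as in ex-round; each quotient is the increase of ξ.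
digit-step-≤ : ∀ {a c n} t X → 1 ≤ a → suc a ≤ c → suc (suc t) ≤ n →
  c * n * (a * X) + (c * suc a * t * X + a * suc a * X)
    ≤ c * n * (suc a * X) + (c * a * t * X + (a ∸ 1) * a * X)
digit-step-≤ {suc a} t X _ a<c t+2≤n with m≤n⇒∃[o]m+o≡n a<c | m≤n⇒∃[o]m+o≡n t+2≤n
... | e , refl | k , refl = ≤″⇒≤ record
  { quotient = X * (2 * suc e + (2 + a + e) * k) ; equality = identity a e k t X }
  where
  identity : ∀ a e k t X →
      (2 + a + e) * (2 + t + k) * (suc a * X) + ((2 + a + e) * (2 + a) * t * X + suc a * (2 + a) * X)
        + X * (2 * suc e + (2 + a + e) * k)
    ≡ (2 + a + e) * (2 + t + k) * ((2 + a) * X) + ((2 + a + e) * suc a * t * X + a * suc a * X)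
  identity = solve-∀

carry-step-≤ : ∀ {c n} t X → 1 ≤ c → suc (suc t) ≤ n →
  c * n * (c * X) + (c * 1 * suc t * (suc c * X) + 0 * 1 * (suc c * X))
    ≤ c * n * (1 * (suc c * X)) + (c * c * t * X + (c ∸ 1) * c * X)
carry-step-≤ {suc c} t X _ t+2≤n with m≤n⇒∃[o]m+o≡n t+2≤n
... | k , refl = ≤″⇒≤ record { quotient = suc c * X * k ; equality = identity c k t X }
  where
  identity : ∀ c k t X →
      suc c * (2 + t + k) * (suc c * X) + (suc c * 1 * suc t * ((2 + c) * X) + 0 * 1 * ((2 + c) * X))
        + suc c * X * k
    ≡ suc c * (2 + t + k) * (1 * ((2 + c) * X)) + (suc c * suc c * t * X + c * suc c * X)
  identity = solve-∀

-- L is given through its predecessor c, so that the factor L ∸ 1 of ex and ξ computes to c.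
module _ {c : ℕ} (1≤c : 1 ≤ c) where
  private
    L : ℕ
    L = suc c
    1<L : 1 < L
    1<L = s≤s 1≤c

  ex-leading : ∀ {a b r} → 1 ≤ a → a < L → r < L ^ b →
    ex L (a * L ^ b + r) ≡ c * a * b * L ^ b + (a ∸ 1) * a * L ^ b + 2 * a * r + ex L r
  ex-leading {a} {b} {r} 1≤a a<L r<Lᵇ = begin
    ex L (a * L ^ b + r)
      ≡⟨ cong (exList L) (expansion-leading L 1<L 1≤a a<L r<Lᵇ) ⟩
    c * a * b * L ^ b + (a ∸ 1) * a * L ^ b + 2 * a * value L (expansion L r) + ex L r
      ≡⟨ cong (λ v → c * a * b * L ^ b + (a ∸ 1) * a * L ^ b + 2 * a * v + ex L r)
              (proj₂ (expansion-correct L 1<L r)) ⟩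
    c * a * b * L ^ b + (a ∸ 1) * a * L ^ b + 2 * a * r + ex L r ∎
    where open ≡-Reasoning

  ex-round : ∀ {a} b → 1 ≤ a → a < L → ex L (a * L ^ b) ≡ c * a * b * L ^ b + (a ∸ 1) * a * L ^ b
  ex-round {a} b 1≤a a<L = begin
    ex L (a * L ^ b)      ≡⟨ cong (λ m → ex L m) (sym (+-identityʳ (a * L ^ b))) ⟩
    ex L (a * L ^ b + 0)  ≡⟨ ex-leading 1≤a a<L (m^n>0 L b) ⟩
    h + 2 * a * 0 + 0     ≡⟨ cong (λ z → h + z + 0) (*-zeroʳ (2 * a)) ⟩
    h + 0 + 0             ≡⟨ trans (+-identityʳ (h + 0)) (+-identityʳ h) ⟩
    h                     ∎
    where
    open ≡-Reasoning
    h = c * a * b * L ^ b + (a ∸ 1) * a * L ^ b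

  exList-bound : ∀ {xs b} → IsExpansion L xs → PositionsBelow b xs → exList L xs ≤ c * b * value L xs
  exList-bound {[]} _ _ = z≤n
  exList-bound {(a , b′) ∷ xs} {b} (1≤a , a<L , below , e) (b′<b ∷ _) = begin
    c * a * b′ * X + (a ∸ 1) * a * X + 2 * a * V + exList L xs
      ≤⟨ +-monoʳ-≤ _ (exList-bound e below) ⟩
    c * a * b′ * X + (a ∸ 1) * a * X + 2 * a * V + c * b′ * V
      ≤⟨ exList-cons-≤ b′ 1≤a (≤-pred a<L) (value-<-pow L e below) ⟩
    c * suc b′ * (a * X + V)
      ≤⟨ *-monoˡ-≤ (a * X + V) (*-monoʳ-≤ c b′<b) ⟩
    c * b * (a * X + V) ∎
    where
    open ≤-Reasoning
    X = L ^ b′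
    V = value L xs

  ex-bound : ∀ {r} b → r < L ^ b → ex L r ≤ c * b * r
  ex-bound {r} b r<Lᵇ =
    let e , eq = expansion-correct L 1<L r
    in subst (λ v → ex L r ≤ c * b * v) eq
         (exList-bound e (positions-below L e (subst (_< L ^ b) (sym eq) r<Lᵇ)))

  ex-tail-bound : ∀ {a b r n} → a < L → r < L ^ b → suc (suc b) ≤ n → 2 * a * r + ex L r ≤ c * n * r
  ex-tail-bound {a} {b} {r} {n} a<L r<Lᵇ b+2≤n = begin
    2 * a * r + ex L r      ≤⟨ +-monoˡ-≤ (ex L r) (*-monoˡ-≤ r (*-monoʳ-≤ 2 (≤-pred a<L))) ⟩
    2 * c * r + ex L r      ≤⟨ +-monoʳ-≤ (2 * c * r) (ex-bound b r<Lᵇ) ⟩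
    2 * c * r + c * b * r   ≡⟨ identity c b r ⟩
    c * (2 + b) * r         ≤⟨ *-monoˡ-≤ r (*-monoʳ-≤ c b+2≤n) ⟩
    c * n * r               ∎
    where
    open ≤-Reasoning
    identity : ∀ c b r → 2 * c * r + c * b * r ≡ c * (2 + b) * r
    identity = solve-∀

  ξ-round-≤-round : ∀ {a b d s n} → 1 ≤ a → a < L → 1 ≤ d → d < L →
    c * n * (a * L ^ b) + (c * d * s * L ^ s + (d ∸ 1) * d * L ^ s)
      ≤ c * n * (d * L ^ s) + (c * a * b * L ^ b + (a ∸ 1) * a * L ^ b) →
    ξ L n (a * L ^ b) ℤ.≤ ξ L n (d * L ^ s)
  ξ-round-≤-round {a} {b} {d} {s} {n} 1≤a a<L 1≤d d<L le = ξ-≤-ξ L n _ _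
    (subst₂ _≤_ (cong (c * n * (a * L ^ b) +_) (sym (ex-round s 1≤d d<L)))
                (cong (c * n * (d * L ^ s) +_) (sym (ex-round b 1≤a a<L))) le)

  ξ-digit-suc : ∀ {a t n} → 1 ≤ a → suc a < L → suc (suc t) ≤ n →
    ξ L n (a * L ^ t) ℤ.≤ ξ L n (suc a * L ^ t)
  ξ-digit-suc {a} {t} 1≤a 1+a<L t+2≤n = ξ-round-≤-round 1≤a (<-trans (n<1+n a) 1+a<L) (s≤s z≤n) 1+a<L
    (digit-step-≤ t (L ^ t) 1≤a (≤-pred 1+a<L) t+2≤n)

  ξ-carry : ∀ {t n} → suc (suc t) ≤ n → ξ L n (c * L ^ t) ℤ.≤ ξ L n (1 * L ^ suc t)
  ξ-carry {t} t+2≤n =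
    ξ-round-≤-round 1≤c (n<1+n c) (s≤s z≤n) 1<L (carry-step-≤ t (L ^ t) 1≤c t+2≤n)

  ξ-tail : ∀ {a b r n} → 1 ≤ a → a < L → r < L ^ b → suc (suc b) ≤ n →
    ξ L n (a * L ^ b) ℤ.≤ ξ L n (a * L ^ b + r)
  ξ-tail {a} {b} {r} {n} 1≤a a<L r<Lᵇ b+2≤n = ξ-≤-ξ L n _ _ (begin
    k * x + ex L (x + r)              ≡⟨ cong (k * x +_) (ex-leading 1≤a a<L r<Lᵇ) ⟩
    k * x + (h + 2 * a * r + ex L r)  ≡⟨ regroup (k * x) h (2 * a * r) (ex L r) ⟩
    k * x + h + (2 * a * r + ex L r)  ≤⟨ +-monoʳ-≤ (k * x + h) (ex-tail-bound a<L r<Lᵇ b+2≤n) ⟩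
    k * x + h + k * r                 ≡⟨ distrib k x r h ⟩
    k * (x + r) + h                   ≡⟨ cong (k * (x + r) +_) (sym (ex-round b 1≤a a<L)) ⟩
    k * (x + r) + ex L x              ∎)
    where
    open ≤-Reasoning
    k = c * n
    x = a * L ^ b
    h = c * a * b * L ^ b + (a ∸ 1) * a * L ^ b
    regroup : ∀ y h t e → y + (h + t + e) ≡ y + h + (t + e)
    regroup = solve-∀
    distrib : ∀ k x r h → k * x + h + k * r ≡ k * (x + r) + h
    distrib = solve-∀

  ξ-digit-mono : ∀ {g a t n} → 1 ≤ g → g ≤ a → a < L → suc (suc t) ≤ n →
    ξ L n (g * L ^ t) ℤ.≤ ξ L n (a * L ^ t)
  ξ-digit-mono {a = zero} (s≤s _) ()
  ξ-digit-mono {g} {suc a} 1≤g g≤1+a 1+a<L t+2≤n with m≤n⇒m<n∨m≡n g≤1+a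
  ... | inj₂ refl = ℤₚ.≤-refl
  ... | inj₁ (s≤s g≤a) = ℤₚ.≤-trans (ξ-digit-mono 1≤g g≤a (<-trans (n<1+n a) 1+a<L) t+2≤n)
                                    (ξ-digit-suc (≤-trans 1≤g g≤a) 1+a<L t+2≤n)

  ξ-to-next-power : ∀ {g t n} → 1 ≤ g → g < L → suc (suc t) ≤ n →
    ξ L n (g * L ^ t) ℤ.≤ ξ L n (1 * L ^ suc t)
  ξ-to-next-power 1≤g g<L t+2≤n =
    ℤₚ.≤-trans (ξ-digit-mono 1≤g (≤-pred g<L) (n<1+n c) t+2≤n) (ξ-carry t+2≤n)

  ξ-to-power : ∀ {g t b n} → 1 ≤ g → g < L → t < b → b < n →
    ξ L n (g * L ^ t) ℤ.≤ ξ L n (1 * L ^ b)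
  ξ-to-power {b = suc b} 1≤g g<L (s≤s t≤b) 1+b<n with m≤n⇒m<n∨m≡n t≤b
  ... | inj₂ refl = ξ-to-next-power 1≤g g<L 1+b<n
  ... | inj₁ t<b = ℤₚ.≤-trans (ξ-to-power 1≤g g<L t<b (<-trans (n<1+n b) 1+b<n))
                              (ξ-to-next-power (s≤s z≤n) 1<L 1+b<n)

  ξ-round-mono : ∀ {g t a b n} → 1 ≤ g → g < L → 1 ≤ a → a < L → suc (suc b) ≤ n →
    t < b ⊎ (t ≡ b × g ≤ a) → ξ L n (g * L ^ t) ℤ.≤ ξ L n (a * L ^ b)
  ξ-round-mono 1≤g g<L 1≤a a<L b+2≤n (inj₁ t<b) =
    ℤₚ.≤-trans (ξ-to-power 1≤g g<L t<b (<-trans (n<1+n _) b+2≤n))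
               (ξ-digit-mono (s≤s z≤n) 1≤a a<L b+2≤n)
  ξ-round-mono 1≤g g<L 1≤a a<L b+2≤n (inj₂ (refl , g≤a)) = ξ-digit-mono 1≤g g≤a a<L b+2≤n

  ξ-round-≤-above : ∀ {g t m n} → 1 ≤ g → g < L → g * L ^ t ≤ m → m ≤ L ^ n →
    ξ L (suc n) (g * L ^ t) ℤ.≤ ξ L (suc n) m
  ξ-round-≤-above {g} {t} {m} {n} 1≤g g<L gLᵗ≤m m≤Lⁿ
    with leading-digit L 1<L (<-≤-trans (<-≤-trans (m^n>0 L t) (pow-≤-digit*pow L t 1≤g)) gLᵗ≤m)
  ... | a , b , r , 1≤a , a<L , r<Lᵇ , refl
    with leading-term-lex L {t = t} {b = b} 1≤g a<L r<Lᵇ gLᵗ≤m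
       | leading-term-≤-pow L 1<L {b = b} 1≤a m≤Lⁿ
  ... | lex | inj₁ b<n =
    ℤₚ.≤-trans (ξ-round-mono 1≤g g<L 1≤a a<L (s≤s b<n) lex) (ξ-tail 1≤a a<L r<Lᵇ (s≤s b<n))
  ... | inj₁ t<n | inj₂ (refl , refl , refl) =
    subst (λ v → ξ L (suc n) (g * L ^ t) ℤ.≤ ξ L (suc n) v) (sym (+-identityʳ (1 * L ^ n)))
      (ξ-to-power 1≤g g<L t<n ≤-refl)
  ... | inj₂ (refl , g≤1) | inj₂ (refl , refl , refl) with ≤-antisym g≤1 1≤g
  ...   | refl = ℤₚ.≤-reflexive (cong (λ v → ξ L (suc n) v) (sym (+-identityʳ (1 * L ^ n))))

mainTheorem6 : (L n g t m : ℕ) → .{{_ : NonZero L}} →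
    2 ≤ L → 2 ≤ n → 1 ≤ g → g ≤ L ∸ 1 →
    g * L ^ t ≤ m → m ≤ L ^ (n ∸ 1) →
    ξ L n (g * L ^ t) ℤ.≤ ξ L n m
mainTheorem6 (suc c) (suc n) g t m (s≤s 1≤c) _ 1≤g g≤c = ξ-round-≤-above 1≤c {t = t} 1≤g (s≤s g≤c)
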